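{- Let $(\mathscr{L},\vdash)$ be a logical structure. Then the following statements are equivalent. (1) $(\mathscr{L},\vdash)$ is of Tarski-type and of Lindenbaum-IV-type. (2) For all $\Gamma\cup\{\alpha\}\subseteq\mathscr{L}$ with $\Gamma\nvdash\alpha$, there exists a strongly closed $\Sigma\supseteq\Gamma$ which is relatively maximal in $\alpha$. (3) For all $\Gamma\cup\{\alpha\}\subseteq\mathscr{L}$ with $\Gamma\nvdash\alpha$, there exists a strongly closed $\alpha$-saturated $\Sigma\supseteq\Gamma$. (4) For all $\Gamma\cup\{\alpha\}\subseteq\mathscr{L}$ with $\Gamma\nvdash\alpha$, there exist $\beta\in\mathscr{L}$ and a strongly closed $\beta$-saturated $\Sigma\supseteq\Gamma$ such that $\Sigma\nvdash\alpha$ and $\{\beta\}\vdash\alpha$. (5) For each $\alpha\in\mathscr{L}$ there exists $\beta\in\mathscr{L}$ such that for every $\Gamma\subseteq\mathscr{L}$, if $\Gamma\nvdash\alpha$ then there exists a strongly closed $\beta$-saturated $\Sigma\supseteq\Gamma$ with $\Sigma\nvdash\alpha$.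
   Context: A logical structure is a pair $(\mathscr{L},\vdash)$ with $\mathscr{L}$ a nonempty set and $\vdash\subseteq\mathcal{P}(\mathscr{L})\times\mathscr{L}$ nonempty; write $\Gamma\vdash\alpha$ for $(\Gamma,\alpha)\in\vdash$. It is of Tarski-type if it is reflexive ($\alpha\in\Gamma\Rightarrow\Gamma\vdash\alpha$), monotone ($\Gamma\vdash\alpha$, $\Gamma\subseteq\Sigma\Rightarrow\Sigma\vdash\alpha$) and transitive (if $\Gamma\vdash\beta$ for all $\beta\in\Sigma$ and $\Sigma\vdash\alpha$ then $\Gamma\vdash\alpha$). $\Gamma$ is strongly closed if $\Gamma\vdash\alpha$ for all $\alpha\in\Gamma$ and, for every $\alpha$, if some $\Gamma'\subseteq\Gamma$ has $\Gamma'\vdash\alpha$ then $\alpha\in\Gamma$. $\Gamma$ is $\alpha$-saturated if $\Gamma\nvdash\alpha$ but $\Gamma\cup\{\beta\}\vdash\alpha$ for all $\beta\in\mathscr{L}\setminus\Gamma$. $\Gamma$ is relatively maximal in $\alpha$ if $\Gamma\nvdash\alpha$ but $\Sigma\vdash\alpha$ for every $\Sigma\supsetneq\Gamma$. $(\mathscr{L},\vdash)$ is of Lindenbaum-IV-type if for all $\Gamma\cup\{\alpha\}$ with $\Gamma\nvdash\alpha$ there is $\Sigma\supseteq\Gamma$ relatively maximal in $\alpha$. -}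

module Defs where

open import Level using (Level; suc)
open import Data.Product using (Σ; ∃; ∃-syntax; _×_; _,_)
open import Relation.Nullary using (¬_)
open import Relation.Unary using (Pred; _∈_; _∉_; _⊆_; _⊂_; _∪_; ｛_｝)

-- Since in set theory subsets are
-- equal iff they have the same elements, we require ⊢ to be invariant under
-- extensional equality of subsets (field ⊢-ext).
record LogicalStructure (ℓ : Level) : Set (suc ℓ) where
  field
    Carrier  : Set ℓ
    _⊢_      : Pred Carrier ℓ → Carrier → Set ℓ
    ⊢-ext    : ∀ {Γ Δ α} → Γ ⊆ Δ → Δ ⊆ Γ → Γ ⊢ α → Δ ⊢ α
    nonempty : Carrier
    ⊢-nonempty : ∃[ Γ ] ∃[ α ] (Γ ⊢ α)

module _ {ℓ : Level} (S : LogicalStructure ℓ) where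
  open LogicalStructure S

  _⊬_ : Pred Carrier ℓ → Carrier → Set ℓ
  Γ ⊬ α = ¬ (Γ ⊢ α)

  Reflexive : Set (suc ℓ)
  Reflexive = ∀ {Γ : Pred Carrier ℓ} {α} → α ∈ Γ → Γ ⊢ α

  Monotone : Set (suc ℓ)
  Monotone = ∀ {Γ Δ : Pred Carrier ℓ} {α} → Γ ⊢ α → Γ ⊆ Δ → Δ ⊢ α

  Transitive : Set (suc ℓ)
  Transitive = ∀ {Γ Δ : Pred Carrier ℓ} {α} →
    (∀ {β} → β ∈ Δ → Γ ⊢ β) → Δ ⊢ α → Γ ⊢ α

  TarskiType : Set (suc ℓ)
  TarskiType = Reflexive × Monotone × Transitive

  StronglyClosed : Pred Carrier ℓ → Set (suc ℓ)
  StronglyClosed Γ =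
    (∀ {α} → α ∈ Γ → Γ ⊢ α) ×
    (∀ {α} (Γ' : Pred Carrier ℓ) → Γ' ⊆ Γ → Γ' ⊢ α → α ∈ Γ)

  Saturated : Carrier → Pred Carrier ℓ → Set ℓ
  Saturated α Γ = Γ ⊬ α × (∀ β → β ∉ Γ → (Γ ∪ ｛ β ｝) ⊢ α)

  -- Σ ⊋ Γ is rendered as Γ ⊂ Σ, i.e. Γ ⊆ Σ and ¬ (Σ ⊆ Γ).
  RelMaximal : Carrier → Pred Carrier ℓ → Set (suc ℓ)
  RelMaximal α Γ = Γ ⊬ α × (∀ (Δ : Pred Carrier ℓ) → Γ ⊂ Δ → Δ ⊢ α)

  LindenbaumIV : Set (suc ℓ)
  LindenbaumIV = ∀ (Γ : Pred Carrier ℓ) α → Γ ⊬ α →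
    ∃[ Δ ] (Γ ⊆ Δ × RelMaximal α Δ)

  Cond1 Cond2 Cond3 Cond4 Cond5 : Set (suc ℓ)
  Cond1 = TarskiType × LindenbaumIV
  Cond2 = ∀ (Γ : Pred Carrier ℓ) α → Γ ⊬ α →
    ∃[ Δ ] (Γ ⊆ Δ × StronglyClosed Δ × RelMaximal α Δ)
  Cond3 = ∀ (Γ : Pred Carrier ℓ) α → Γ ⊬ α →
    ∃[ Δ ] (Γ ⊆ Δ × StronglyClosed Δ × Saturated α Δ)
  Cond4 = ∀ (Γ : Pred Carrier ℓ) α → Γ ⊬ α →
    ∃[ β ] ∃[ Δ ] (Γ ⊆ Δ × StronglyClosed Δ × Saturated β Δ ×
                   Δ ⊬ α × (｛ β ｝ ⊢ α))
  Cond5 = ∀ α → ∃[ β ] (∀ (Γ : Pred Carrier ℓ) → Γ ⊬ α →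
    ∃[ Δ ] (Γ ⊆ Δ × StronglyClosed Δ × Saturated β Δ × Δ ⊬ α))

-- The conditions form the cycle (1) ⇒ (2) ⇒ (3) ⇒ (5) ⇒ (4) ⇒ (1).  Each of
-- (2)–(5) provides strongly closed extensions avoiding any unprovable formula,
-- which already forces the Tarski laws: Γ ⊢ α holds as soon as α lies in
-- every strongly closed Σ ⊇ Γ.  Relative maximality and saturation agree for
-- monotone structures, since any proper superset of Σ contains Σ ∪ {γ} for some
-- γ ∉ Σ; and a β-saturated Σ ⊬ α yields relative maximality in α once
-- {β} ⊢ α, which in (5) is forced by extending {β} itself.
module Submission where

open import Defs
open import Level using (Level; suc)
open import Data.Product using (_×_; _,_; ∃-syntax)
open import Data.Sum using (inj₁; inj₂)
open import Data.Empty using (⊥-elim)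
open import Function.Base using (_∘_)
open import Function.Bundles using (_⇔_; mk⇔)
open import Axiom.ExcludedMiddle using (ExcludedMiddle)
open import Relation.Nullary using (¬_; yes; no)
open import Relation.Unary using (Pred; _∈_; _∉_; _⊆_; _⊂_; _∪_; ｛_｝)
open import Relation.Binary.PropositionalEquality using (refl)

module Cycle {ℓ : Level} (em : ExcludedMiddle ℓ) (S : LogicalStructure ℓ) where
  open LogicalStructure S

  ClosedExtensions : Set (suc ℓ)
  ClosedExtensions = ∀ (Γ : Pred Carrier ℓ) α → ¬ (Γ ⊢ α) →
    ∃[ Δ ] (Γ ⊆ Δ × StronglyClosed S Δ × ¬ (Δ ⊢ α))

  ⊢-fromClosedExtensions : ClosedExtensions → ∀ {Γ α} →
    (∀ Δ → Γ ⊆ Δ → StronglyClosed S Δ → α ∈ Δ) → Γ ⊢ α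
  ⊢-fromClosedExtensions ext {Γ} {α} α∈closed with em {Γ ⊢ α}
  ... | yes Γ⊢α = Γ⊢α
  ... | no Γ⊬α with ext Γ α Γ⊬α
  ... | Δ , Γ⊆Δ , closed@(⊢-elems , _) , Δ⊬α =
    ⊥-elim (Δ⊬α (⊢-elems (α∈closed Δ Γ⊆Δ closed)))

  closedExtensions⇒tarskiType : ClosedExtensions → TarskiType S
  closedExtensions⇒tarskiType ext = reflexive , monotone , transitive
    where
    reflexive : Reflexive S
    reflexive α∈Γ = ⊢-fromClosedExtensions ext λ _ Γ⊆Δ _ → Γ⊆Δ α∈Γ

    monotone : Monotone S
    monotone {Γ} Γ⊢α Γ⊆Σ = ⊢-fromClosedExtensions ext
      λ _ Σ⊆Δ (_ , deductive) → deductive Γ (Σ⊆Δ ∘ Γ⊆Σ) Γ⊢α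

    transitive : Transitive S
    transitive {Δ = Σ} Γ⊢Σ Σ⊢α = ⊢-fromClosedExtensions ext
      λ _ Γ⊆Δ (_ , deductive) →
        deductive Σ (deductive _ Γ⊆Δ ∘ Γ⊢Σ) Σ⊢α

  element-∉ : ∀ {Σ Δ : Pred Carrier ℓ} → ¬ (Δ ⊆ Σ) → ∃[ γ ] (γ ∈ Δ × γ ∉ Σ)
  element-∉ {Σ} {Δ} Δ⊈Σ with em {∃[ γ ] (γ ∈ Δ × γ ∉ Σ)}
  ... | yes witness = witness
  ... | no none = ⊥-elim (Δ⊈Σ Δ⊆Σ)
    where
    Δ⊆Σ : Δ ⊆ Σ
    Δ⊆Σ {γ} γ∈Δ with em {γ ∈ Σ}
    ... | yes γ∈Σ = γ∈Σ
    ... | no γ∉Σ = ⊥-elim (none (γ , γ∈Δ , γ∉Σ))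

  saturated⇒⊂⇒⊢ : Monotone S → ∀ {β Σ Δ} →
    Saturated S β Σ → Σ ⊂ Δ → Δ ⊢ β
  saturated⇒⊂⇒⊢ monotone (_ , saturate) (Σ⊆Δ , Δ⊈Σ) with element-∉ Δ⊈Σ
  ... | γ , γ∈Δ , γ∉Σ = monotone (saturate γ γ∉Σ) λ where
    (inj₁ δ∈Σ) → Σ⊆Δ δ∈Σ
    (inj₂ refl) → γ∈Δ

  relMaximal⇒saturated : ∀ {α Σ} → RelMaximal S α Σ → Saturated S α Σ
  relMaximal⇒saturated (Σ⊬α , maximal) =
    Σ⊬α , λ β β∉Σ → maximal _ (inj₁ , λ Σ∪β⊆Σ → β∉Σ (Σ∪β⊆Σ (inj₂ refl)))

  tarskiType∧saturated⇒stronglyClosed : TarskiType S → ∀ {α Σ} →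
    Saturated S α Σ → StronglyClosed S Σ
  tarskiType∧saturated⇒stronglyClosed (reflexive , monotone , transitive)
    {α} {Σ} (Σ⊬α , saturate) = reflexive , deductive
    where
    deductive : ∀ {β} Γ → Γ ⊆ Σ → Γ ⊢ β → β ∈ Σ
    deductive {β} Γ Γ⊆Σ Γ⊢β with em {β ∈ Σ}
    ... | yes β∈Σ = β∈Σ
    ... | no β∉Σ = ⊥-elim (Σ⊬α (transitive Σ⊢Σ∪β (saturate β β∉Σ)))
      where
      Σ⊢Σ∪β : ∀ {γ} → γ ∈ (Σ ∪ ｛ β ｝) → Σ ⊢ γ
      Σ⊢Σ∪β (inj₁ γ∈Σ) = reflexive γ∈Σ
      Σ⊢Σ∪β (inj₂ refl) = monotone Γ⊢β Γ⊆Σ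

  1⇒2 : Cond1 S → Cond2 S
  1⇒2 (tarski , lindenbaum) Γ α Γ⊬α with lindenbaum Γ α Γ⊬α
  ... | Σ , Γ⊆Σ , maximal =
    Σ , Γ⊆Σ ,
    tarskiType∧saturated⇒stronglyClosed tarski (relMaximal⇒saturated maximal) ,
    maximal

  2⇒3 : Cond2 S → Cond3 S
  2⇒3 cond2 Γ α Γ⊬α with cond2 Γ α Γ⊬α
  ... | Σ , Γ⊆Σ , closed , maximal =
    Σ , Γ⊆Σ , closed , relMaximal⇒saturated maximal

  3⇒5 : Cond3 S → Cond5 S
  3⇒5 cond3 α = α , λ Γ Γ⊬α → extend Γ Γ⊬α
    where
    extend : ∀ Γ → ¬ (Γ ⊢ α) →
      ∃[ Σ ] (Γ ⊆ Σ × StronglyClosed S Σ × Saturated S α Σ × ¬ (Σ ⊢ α))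
    extend Γ Γ⊬α with cond3 Γ α Γ⊬α
    ... | Σ , Γ⊆Σ , closed , saturated@(Σ⊬α , _) =
      Σ , Γ⊆Σ , closed , saturated , Σ⊬α

  5⇒4 : Cond5 S → Cond4 S
  5⇒4 cond5 Γ α Γ⊬α with cond5 α
  ... | β , extend with extend Γ Γ⊬α
  ... | Σ , Γ⊆Σ , closed , saturated , Σ⊬α =
    β , Σ , Γ⊆Σ , closed , saturated , Σ⊬α , β⊢α
    where
    -- Extending {β} to a β-saturated strongly closed set would prove β.
    β⊢α : ｛ β ｝ ⊢ α
    β⊢α with em {｛ β ｝ ⊢ α}
    ... | yes β⊢α = β⊢α
    ... | no β⊬α with extend ｛ β ｝ β⊬α
    ... | Δ , β∈Δ , (⊢-elems , _) , (Δ⊬β , _) , _ = ⊥-elim (Δ⊬β (⊢-elems (β∈Δ refl)))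

  4⇒1 : Cond4 S → Cond1 S
  4⇒1 cond4 = tarski , lindenbaum
    where
    tarski : TarskiType S
    tarski = closedExtensions⇒tarskiType λ Γ α Γ⊬α →
      let (_ , Σ , Γ⊆Σ , closed , _ , Σ⊬α , _) = cond4 Γ α Γ⊬α
      in Σ , Γ⊆Σ , closed , Σ⊬α

    lindenbaum : LindenbaumIV S
    lindenbaum Γ α Γ⊬α with cond4 Γ α Γ⊬α
    ... | β , Σ , Γ⊆Σ , _ , saturated , Σ⊬α , β⊢α =
      Σ , Γ⊆Σ , Σ⊬α , λ Δ Σ⊂Δ →
        let (_ , monotone , transitive) = tarski
        in transitive (λ { refl → saturated⇒⊂⇒⊢ monotone saturated Σ⊂Δ }) β⊢α

mainTheorem3 : {ℓ : Level} → ExcludedMiddle ℓ → ExcludedMiddle (suc ℓ) →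
    (S : LogicalStructure ℓ) →
    (Cond1 S ⇔ Cond2 S) × (Cond1 S ⇔ Cond3 S) ×
    (Cond1 S ⇔ Cond4 S) × (Cond1 S ⇔ Cond5 S)
mainTheorem3 em _ S =
  mk⇔ 1⇒2 (4⇒1 ∘ 5⇒4 ∘ 3⇒5 ∘ 2⇒3) ,
  mk⇔ (2⇒3 ∘ 1⇒2) (4⇒1 ∘ 5⇒4 ∘ 3⇒5) ,
  mk⇔ (5⇒4 ∘ 3⇒5 ∘ 2⇒3 ∘ 1⇒2) 4⇒1 ,
  mk⇔ (3⇒5 ∘ 2⇒3 ∘ 1⇒2) (4⇒1 ∘ 5⇒4)
  where open Cycle em S
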